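{- Every finite binary tree $T$ has a subdivision $T'$ with $i_{1,1}(T')\le 2$.
   Context: Discrete-time immunization model with $r=s=1$. For a finite graph $H$, a protocol is a finite sequence $(A_1,\dots,A_N)$ of subsets of $V(H)$ (vertices immunized at time-step $t$); its width is $\max_i|A_i|$. At time $0$ all vertices are red. For $t\ge1$ each vertex is green, yellow or red at time $t$: if $v\in A_t$ then $v$ is green; otherwise, a vertex red or yellow at time $t-1$ is red at time $t$, and a vertex green at time $t-1$ becomes yellow at time $t$ if it has a neighbor that is red at time $t$, and stays green otherwise. The protocol clears $H$ if all vertices are green at time $N$. $i_{1,1}(H)$ is the minimum width of a protocol that clears $H$. A binary tree is a rooted tree in which each vertex has at most two children. A subdivision of a graph is obtained by replacing edges by paths with new internal vertices. -}

module Defs where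

open import Data.Bool using (Bool; true; false; if_then_else_; not; _∧_; _∨_)
open import Data.Nat using (ℕ; zero; suc; _+_; _≤_)
open import Data.Fin using (Fin; zero; suc; _↑ˡ_; _↑ʳ_; _≟_)
open import Data.Fin.Subset using (Subset; ∣_∣)
open import Data.Vec using (lookup)
open import Data.List using (List; []; _∷_; _++_; map; foldl)
open import Data.Bool.ListAction using (any)
open import Relation.Binary.PropositionalEquality using (_≡_)
open import Data.List.Relation.Unary.All using (All)
open import Data.Product using (_×_; _,_; Σ; proj₁; proj₂)
open import Relation.Nullary.Decidable using (⌊_⌋)

-- Finite (simple, undirected) graphs: vertex set Fin n, edges given as a
-- list of unordered pairs (u , v) meaning u ~ v.

record Graph : Set where
  field
    n     : ℕ
    edges : List (Fin n × Fin n)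
open Graph public

-- The immunization process with r = s = 1.

data Colour : Set where
  green yellow red : Colour

notGreen : Colour → Bool
notGreen green  = false
notGreen yellow = true
notGreen red    = true

isRed : Colour → Bool
isRed red = true
isRed _   = false

State : Graph → Set
State G = Fin (n G) → Colour

step : (G : Graph) → Subset (n G) → State G → State G
step G A s v =
  if lookup A v then green
  else if notGreen (s v) then red
  else (if hasRedNbr then yellow else green)
  where
  redNow : Fin (n G) → Bool
  redNow u = not (lookup A u) ∧ notGreen (s u)
  hasRedNbr : Bool
  hasRedNbr = any (λ e → (⌊ proj₁ e ≟ v ⌋ ∧ redNow (proj₂ e))
                       ∨ (⌊ proj₂ e ≟ v ⌋ ∧ redNow (proj₁ e))) (edges G)

Protocol : Graph → Set
Protocol G = List (Subset (n G))

allRed : (G : Graph) → State G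
allRed G _ = red

run : (G : Graph) → Protocol G → State G
run G P = foldl (λ s A → step G A s) (allRed G) P

Clears : (G : Graph) → Protocol G → Set
Clears G P = (v : Fin (n G)) → run G P v ≡ green

WidthAtMost : (G : Graph) → ℕ → Protocol G → Set
WidthAtMost G k P = All (λ A → ∣ A ∣ ≤ k) P

-- i_{1,1}(G) ≤ k  (i_{1,1} is the minimum width of a clearing protocol)
i₁₁≤ : Graph → ℕ → Set
i₁₁≤ G k = Σ (Protocol G) λ P → WidthAtMost G k P × Clears G P

data BTree : Set where
  leaf  : BTree
  node1 : BTree → BTree
  node2 : BTree → BTree → BTree

size : BTree → ℕ
size leaf        = 1
size (node1 t)   = suc (size t)
size (node2 l r) = suc (size l + size r)

root : (t : BTree) → Fin (size t)
root leaf        = zero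
root (node1 t)   = zero
root (node2 l r) = zero

-- vertex 0 is the root; the children's subtrees follow in order
treeEdges : (t : BTree) → List (Fin (size t) × Fin (size t))
treeEdges leaf = []
treeEdges (node1 t) =
  (zero , suc (root t)) ∷ map (λ e → suc (proj₁ e) , suc (proj₂ e)) (treeEdges t)
treeEdges (node2 l r) =
  (zero , suc (root l ↑ˡ size r)) ∷ (zero , suc (size l ↑ʳ root r))
  ∷ (map (λ e → suc (proj₁ e ↑ˡ size r) , suc (proj₂ e ↑ˡ size r)) (treeEdges l)
     ++ map (λ e → suc (size l ↑ʳ proj₁ e) , suc (size l ↑ʳ proj₂ e)) (treeEdges r))

treeGraph : BTree → Graph
treeGraph t = record { n = size t ; edges = treeEdges t }

-- Subdivisions of a binary tree: each edge (parent–child) gets a number k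
-- of new internal vertices, i.e. is replaced by a path with k internal vertices.

data Subdiv : BTree → Set where
  leaf  : Subdiv leaf
  node1 : ∀ {t} → ℕ → Subdiv t → Subdiv (node1 t)
  node2 : ∀ {l r} → ℕ → Subdiv l → ℕ → Subdiv r → Subdiv (node2 l r)

chain : ℕ → BTree → BTree
chain zero    t = t
chain (suc k) t = node1 (chain k t)

subdivide : ∀ {t} → Subdiv t → BTree
subdivide leaf              = leaf
subdivide (node1 k s)       = node1 (chain k (subdivide s))
subdivide (node2 k s k′ s′) = node2 (chain k (subdivide s)) (chain k′ (subdivide s′))

-- Clear the tree bottom-up, keeping the vertex above the current subtree red. At a unary vertex,
-- clear the child's subtree and then immunize the vertex. At a binary vertex with children l and r,
-- clear l and then r. While r is being cleared, the red vertex re-infects l from above, one level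
-- per step (the top vertex turns yellow, then red, and so on downwards). The subdivision inserts
-- above l a path at least as long as the protocol clearing r, so the infection never leaves that
-- path; it is then healed from its lowest infected vertex upwards, one vertex per step, while the
-- root of r is immunized at every step to keep r green. Finally the vertex itself is immunized.
-- No step immunizes more than two vertices.

module Submission where

open import Defs hiding (n)
open import Data.Bool using (Bool; true; false; if_then_else_; not; _∧_; _∨_)
open import Data.Bool.Properties using (∨-identityʳ; ∨-zeroʳ; ∨-comm; ∨-assoc; ∧-zeroʳ)
open import Data.Bool.ListAction using (any)
open import Data.Empty using (⊥)
open import Data.Fin using (Fin; zero; suc; _↑ˡ_; _↑ʳ_; _≟_; splitAt)
open import Data.Fin.Properties
  using (suc-injective; ↑ˡ-injective; ↑ʳ-injective; splitAt-↑ˡ; splitAt-↑ʳ; splitAt⁻¹-↑ˡ; splitAt⁻¹-↑ʳ)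
open import Data.Fin.Subset using (Subset; ⁅_⁆; ∣_∣) renaming (⊥ to ∅)
open import Data.Fin.Subset.Properties using (∣⊥∣≡0; ∣⁅x⁆∣≡1; x∈⁅x⁆)
open import Data.List using (List; []; _∷_; _++_; map; foldl; length; replicate; _∷ʳ_)
open import Data.List.Properties using (foldl-++; map-id)
open import Data.List.Relation.Unary.All using (All; []; _∷_)
open import Data.List.Relation.Unary.All.Properties using (map⁺; gmap⁺; ++⁺)
open import Data.Nat using (ℕ; zero; suc; _+_; _≤_; z≤n; s≤s)
open import Data.Nat.Properties using (+-identityʳ; +-suc; +-mono-≤; ≤-reflexive; ≤-trans; m≤m+n)
open import Data.Product using (Σ; _×_; _,_; proj₁; proj₂)
open import Data.Sum using (inj₁; inj₂)
open import Data.Unit using (⊤; tt)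
open import Data.Vec using ([]; _∷_; lookup) renaming (_++_ to _++ᵛ_)
open import Data.Vec.Properties using (lookup-++ˡ; lookup-++ʳ; lookup-replicate; []=⇒lookup)
open import Function using (_∘_; Injective; mk⇔)
open import Relation.Binary.PropositionalEquality
open import Relation.Nullary using (yes; no)
open import Relation.Nullary.Decidable using (⌊_⌋; isYes≗does; does-⇔; dec-false)

open ≡-Reasoning

private
  variable
    m n : ℕ

⌊≟⌋-injective : {f : Fin m → Fin n} → Injective _≡_ _≡_ f → ∀ x y → ⌊ f x ≟ f y ⌋ ≡ ⌊ x ≟ y ⌋
⌊≟⌋-injective {f = f} inj x y = begin
  ⌊ f x ≟ f y ⌋ ≡⟨ isYes≗does (f x ≟ f y) ⟩
  _             ≡⟨ does-⇔ (mk⇔ inj (cong f)) (f x ≟ f y) (x ≟ y) ⟩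
  _             ≡⟨ sym (isYes≗does (x ≟ y)) ⟩
  ⌊ x ≟ y ⌋     ∎

⌊≟⌋-≢ : {x y : Fin n} → x ≢ y → ⌊ x ≟ y ⌋ ≡ false
⌊≟⌋-≢ {x = x} {y} x≢y = trans (isYes≗does (x ≟ y)) (dec-false (x ≟ y) x≢y)

Edges : ℕ → Set
Edges n = List (Fin n × Fin n)

mapEdges : (Fin m → Fin n) → Edges m → Edges n
mapEdges f = map (λ e → f (proj₁ e) , f (proj₂ e))

adjacentTo : Edges n → (Fin n → Bool) → Fin n → Bool
adjacentTo es R v = any (λ e → (⌊ proj₁ e ≟ v ⌋ ∧ R (proj₂ e)) ∨ (⌊ proj₂ e ≟ v ⌋ ∧ R (proj₁ e))) es

adjacentTo-cong : ∀ (es : Edges n) {R R′} → R ≗ R′ → ∀ v → adjacentTo es R v ≡ adjacentTo es R′ v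
adjacentTo-cong []             R≗R′ v = refl
adjacentTo-cong ((x , y) ∷ es) R≗R′ v
  rewrite R≗R′ x | R≗R′ y = cong (_ ∨_) (adjacentTo-cong es R≗R′ v)

adjacentTo-none : ∀ (es : Edges n) {R} → (∀ u → R u ≡ false) → ∀ v → adjacentTo es R v ≡ false
adjacentTo-none []             none v = refl
adjacentTo-none ((x , y) ∷ es) none v
  rewrite none x | none y | ∧-zeroʳ ⌊ x ≟ v ⌋ | ∧-zeroʳ ⌊ y ≟ v ⌋ = adjacentTo-none es none v

adjacentTo-++ : ∀ (xs ys : Edges n) R v →
                adjacentTo (xs ++ ys) R v ≡ adjacentTo xs R v ∨ adjacentTo ys R v
adjacentTo-++ []             ys R v = refl
adjacentTo-++ ((x , y) ∷ xs) ys R v =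
  trans (cong (_ ∨_) (adjacentTo-++ xs ys R v))
        (sym (∨-assoc ((⌊ x ≟ v ⌋ ∧ R y) ∨ (⌊ y ≟ v ⌋ ∧ R x)) (adjacentTo xs R v) (adjacentTo ys R v)))

adjacentTo-mapEdges : {f : Fin m → Fin n} → Injective _≡_ _≡_ f → ∀ es R v →
                      adjacentTo (mapEdges f es) R (f v) ≡ adjacentTo es (R ∘ f) v
adjacentTo-mapEdges inj []             R v = refl
adjacentTo-mapEdges inj ((x , y) ∷ es) R v
  rewrite ⌊≟⌋-injective inj x v | ⌊≟⌋-injective inj y v = cong (_ ∨_) (adjacentTo-mapEdges inj es R v)

adjacentTo-mapEdges-∉ : {f : Fin m → Fin n} {w : Fin n} → (∀ x → f x ≢ w) → ∀ es R →
                        adjacentTo (mapEdges f es) R w ≡ false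
adjacentTo-mapEdges-∉         w∉f []             R = refl
adjacentTo-mapEdges-∉ {f = f} w∉f ((x , y) ∷ es) R
  rewrite ⌊≟⌋-≢ (w∉f x) | ⌊≟⌋-≢ (w∉f y) = adjacentTo-mapEdges-∉ w∉f es R

Colouring : BTree → Set
Colouring t = Fin (size t) → Colour

nextColour : Bool → Colour → Bool → Colour
nextColour immunized c redNeighbour =
  if immunized then green else if notGreen c then red else if redNeighbour then yellow else green

nextColour-infected : ∀ {c} h → notGreen c ≡ true → nextColour false c h ≡ red
nextColour-infected {green}  h ()
nextColour-infected {yellow} h _ = refl
nextColour-infected {red}    h _ = refl

redNow : Subset n → (Fin n → Colour) → Fin n → Bool
redNow A s u = not (lookup A u) ∧ notGreen (s u)

redNow-cong : ∀ (A : Subset n) {s s′} → s ≗ s′ → redNow A s ≗ redNow A s′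
redNow-cong A s≗s′ u = cong (λ c → not (lookup A u) ∧ notGreen c) (s≗s′ u)

-- One step on the subtree t, whose root has a parent outside t that is red now iff parentRed.
stepBelow : (t : BTree) → (parentRed : Bool) → Subset (size t) → Colouring t → Colouring t
stepBelow t parentRed A s v =
  nextColour (lookup A v) (s v) (adjacentTo (treeEdges t) (redNow A s) v ∨ (⌊ root t ≟ v ⌋ ∧ parentRed))

step-treeGraph : ∀ t A s → step (treeGraph t) A s ≗ stepBelow t false A s
step-treeGraph t A s v = cong (nextColour (lookup A v) (s v)) (sym (begin
  red? ∨ (⌊ root t ≟ v ⌋ ∧ false) ≡⟨ cong (red? ∨_) (∧-zeroʳ _) ⟩
  red? ∨ false                    ≡⟨ ∨-identityʳ red? ⟩
  red?                            ∎))
  where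
  red? = adjacentTo (treeEdges t) (redNow A s) v

stepBelow-cong : ∀ t b A {s s′ : Colouring t} → s ≗ s′ → stepBelow t b A s ≗ stepBelow t b A s′
stepBelow-cong t b A {s} {s′} s≗s′ v =
  cong₂ (λ c h → nextColour (lookup A v) c (h ∨ (⌊ root t ≟ v ⌋ ∧ b))) (s≗s′ v)
        (adjacentTo-cong (treeEdges t) (redNow-cong A s≗s′) v)

runBelow : (t : BTree) → Bool → List (Subset (size t)) → Colouring t → Colouring t
runBelow t b P s = foldl (λ σ A → stepBelow t b A σ) s P

runBelow-++ : ∀ t b P Q s → runBelow t b (P ++ Q) s ≡ runBelow t b Q (runBelow t b P s)
runBelow-++ t b P Q s = foldl-++ (λ σ A → stepBelow t b A σ) s P Q

runBelow-cong : ∀ t b P {s s′ : Colouring t} → s ≗ s′ → runBelow t b P s ≗ runBelow t b P s′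
runBelow-cong t b []      s≗s′ = s≗s′
runBelow-cong t b (A ∷ P) s≗s′ = runBelow-cong t b P (stepBelow-cong t b A s≗s′)

run-treeGraph : ∀ t P → run (treeGraph t) P ≗ runBelow t false P (allRed (treeGraph t))
run-treeGraph t P = go P (λ _ → refl)
  where
  go : ∀ P {s s′} → s ≗ s′ → foldl (λ σ A → step (treeGraph t) A σ) s P ≗ runBelow t false P s′
  go []      s≗s′ = s≗s′
  go (A ∷ P) {s} s≗s′ = go P (λ v → trans (step-treeGraph t A s v) (stepBelow-cong t false A s≗s′ v))

AllGreen : (t : BTree) → Colouring t → Set
AllGreen t s = ∀ v → s v ≡ green

AllRed : (t : BTree) → Colouring t → Set
AllRed t s = ∀ v → s v ≡ red

allRed-step : ∀ t b s → AllRed t s → AllRed t (stepBelow t b ∅ s)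
allRed-step t b s s-red v rewrite lookup-replicate v false | s-red v = refl

allGreen-step : ∀ t b A s → (b ≡ true → lookup A (root t) ≡ true) →
                AllGreen t s → AllGreen t (stepBelow t b A s)
allGreen-step t b A s rootGuarded s-green v with lookup A v in A[v]
... | true  = refl
... | false = cong₂ (nextColour false) (s-green v) (cong₂ _∨_ noRedNeighbour (parentHarmless b rootGuarded))
  where
  noRedNeighbour : adjacentTo (treeEdges t) (redNow A s) v ≡ false
  noRedNeighbour = adjacentTo-none (treeEdges t) (λ u → trans (redNow-cong A s-green u) (∧-zeroʳ _)) v
  parentHarmless : ∀ b → (b ≡ true → lookup A (root t) ≡ true) → ⌊ root t ≟ v ⌋ ∧ b ≡ false
  parentHarmless false _ = ∧-zeroʳ _
  parentHarmless true rootGuarded with root t ≟ v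
  ... | no _     = refl
  ... | yes refl with () ← trans (sym (rootGuarded refl)) A[v]

runBelow-invariant : ∀ {X : Set} t b A (Inv : Colouring t → Set) → (∀ s → Inv s → Inv (stepBelow t b A s)) →
                     ∀ (P : List X) s → Inv s → Inv (runBelow t b (map (λ _ → A) P) s)
runBelow-invariant t b A Inv step-Inv []      s inv = inv
runBelow-invariant t b A Inv step-Inv (_ ∷ P) s inv =
  runBelow-invariant t b A Inv step-Inv P (stepBelow t b A s) (step-Inv s inv)

adjacentTo-node1 : ∀ t R i → adjacentTo (treeEdges (node1 t)) R (suc i)
                              ≡ adjacentTo (treeEdges t) (R ∘ suc) i ∨ (⌊ root t ≟ i ⌋ ∧ R zero)
adjacentTo-node1 t R i = trans
  (cong₂ (λ x y → (x ∧ R zero) ∨ y)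
         (⌊≟⌋-injective suc-injective (root t) i) (adjacentTo-mapEdges suc-injective (treeEdges t) R i))
  (∨-comm (⌊ root t ≟ i ⌋ ∧ R zero) _)

stepBelow-node1 : ∀ t b a A s {ρ} → redNow (a ∷ A) s zero ≡ ρ →
                  stepBelow (node1 t) b (a ∷ A) s ∘ suc ≗ stepBelow t ρ A (s ∘ suc)
stepBelow-node1 t b a A s {ρ} ρ-eq i = cong (nextColour (lookup A i) (s (suc i))) (begin
  adjacentTo (treeEdges (node1 t)) R (suc i) ∨ false ≡⟨ ∨-identityʳ _ ⟩
  adjacentTo (treeEdges (node1 t)) R (suc i)         ≡⟨ adjacentTo-node1 t R i ⟩
  red? ∨ (⌊ root t ≟ i ⌋ ∧ R zero)                   ≡⟨ cong (λ x → red? ∨ (⌊ root t ≟ i ⌋ ∧ x)) ρ-eq ⟩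
  red? ∨ (⌊ root t ≟ i ⌋ ∧ ρ)                        ∎)
  where
  R = redNow (a ∷ A) s
  red? = adjacentTo (treeEdges t) (R ∘ suc) i

runBelow-node1 : ∀ t b P s → s zero ≡ red →
                 let s′ = runBelow (node1 t) b (map (false ∷_) P) s in
                 s′ zero ≡ red × s′ ∘ suc ≗ runBelow t true P (s ∘ suc)
runBelow-node1 t b []      s s₀ = s₀ , λ _ → refl
runBelow-node1 t b (A ∷ P) s s₀ =
  proj₁ rest , λ i → trans (proj₂ rest i) (runBelow-cong t true P (stepBelow-node1 t b false A s infected) i)
  where
  infected = cong notGreen s₀
  rest = runBelow-node1 t b P (stepBelow (node1 t) b (false ∷ A) s) (nextColour-infected _ infected)

allGreen-node1 : ∀ {t} {s : Colouring (node1 t)} →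
                 s zero ≡ green → AllGreen t (s ∘ suc) → AllGreen (node1 t) s
allGreen-node1 g₀ g zero    = g₀
allGreen-node1 g₀ g (suc v) = g v

rootImmunized-node1 : ∀ t b s → AllGreen t (s ∘ suc) → AllGreen (node1 t) (stepBelow (node1 t) b (true ∷ ∅) s)
rootImmunized-node1 t b s g = allGreen-node1 refl λ i →
  trans (stepBelow-node1 t b true ∅ s refl i) (allGreen-step t false ∅ (s ∘ suc) (λ ()) g i)

module Node2 (l r : BTree) where

  inLeft : Fin (size l) → Fin (size (node2 l r))
  inLeft i = suc (i ↑ˡ size r)

  inRight : Fin (size r) → Fin (size (node2 l r))
  inRight i = suc (size l ↑ʳ i)

  rootOnly : Subset (size (node2 l r))
  rootOnly = true ∷ (∅ {size l} ++ᵛ ∅ {size r})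

  inLeft-injective : Injective _≡_ _≡_ inLeft
  inLeft-injective = ↑ˡ-injective (size r) _ _ ∘ suc-injective

  inRight-injective : Injective _≡_ _≡_ inRight
  inRight-injective = ↑ʳ-injective (size l) _ _ ∘ suc-injective

  inLeft≢inRight : ∀ x y → inLeft x ≢ inRight y
  inLeft≢inRight x y eq with () ← begin
    inj₁ x                          ≡⟨ splitAt-↑ˡ (size l) x (size r) ⟨
    splitAt (size l) (x ↑ˡ size r)  ≡⟨ cong (splitAt (size l)) (suc-injective eq) ⟩
    splitAt (size l) (size l ↑ʳ y)  ≡⟨ splitAt-↑ʳ (size l) (size r) y ⟩
    inj₂ y                          ∎

  adjacentTo-left : ∀ R i → adjacentTo (treeEdges (node2 l r)) R (inLeft i)
                            ≡ adjacentTo (treeEdges l) (R ∘ inLeft) i ∨ (⌊ root l ≟ i ⌋ ∧ R zero)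
  adjacentTo-left R i = begin
    (⌊ inLeft (root l) ≟ inLeft i ⌋ ∧ R zero) ∨ ((⌊ inRight (root r) ≟ inLeft i ⌋ ∧ R zero) ∨ red? (Eₗ ++ Eᵣ))
      ≡⟨ cong₂ (λ x y → (x ∧ R zero) ∨ ((y ∧ R zero) ∨ red? (Eₗ ++ Eᵣ)))
               (⌊≟⌋-injective inLeft-injective (root l) i) (⌊≟⌋-≢ (λ eq → inLeft≢inRight i (root r) (sym eq))) ⟩
    viaRoot ∨ red? (Eₗ ++ Eᵣ)
      ≡⟨ cong (viaRoot ∨_) (adjacentTo-++ Eₗ Eᵣ R (inLeft i)) ⟩
    viaRoot ∨ (red? Eₗ ∨ red? Eᵣ)
      ≡⟨ cong₂ (λ x y → viaRoot ∨ (x ∨ y))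
               (adjacentTo-mapEdges inLeft-injective (treeEdges l) R i)
               (adjacentTo-mapEdges-∉ (λ x eq → inLeft≢inRight i x (sym eq)) (treeEdges r) R) ⟩
    viaRoot ∨ (adjacentTo (treeEdges l) (R ∘ inLeft) i ∨ false)
      ≡⟨ cong (viaRoot ∨_) (∨-identityʳ _) ⟩
    viaRoot ∨ adjacentTo (treeEdges l) (R ∘ inLeft) i
      ≡⟨ ∨-comm viaRoot _ ⟩
    adjacentTo (treeEdges l) (R ∘ inLeft) i ∨ viaRoot ∎
    where
    Eₗ = mapEdges inLeft (treeEdges l)
    Eᵣ = mapEdges inRight (treeEdges r)
    red? = λ E → adjacentTo E R (inLeft i)
    viaRoot = ⌊ root l ≟ i ⌋ ∧ R zero

  adjacentTo-right : ∀ R i → adjacentTo (treeEdges (node2 l r)) R (inRight i)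
                             ≡ adjacentTo (treeEdges r) (R ∘ inRight) i ∨ (⌊ root r ≟ i ⌋ ∧ R zero)
  adjacentTo-right R i = begin
    (⌊ inLeft (root l) ≟ inRight i ⌋ ∧ R zero) ∨ ((⌊ inRight (root r) ≟ inRight i ⌋ ∧ R zero) ∨ red? (Eₗ ++ Eᵣ))
      ≡⟨ cong₂ (λ x y → (x ∧ R zero) ∨ ((y ∧ R zero) ∨ red? (Eₗ ++ Eᵣ)))
               (⌊≟⌋-≢ (inLeft≢inRight (root l) i)) (⌊≟⌋-injective inRight-injective (root r) i) ⟩
    viaRoot ∨ red? (Eₗ ++ Eᵣ)
      ≡⟨ cong (viaRoot ∨_) (adjacentTo-++ Eₗ Eᵣ R (inRight i)) ⟩
    viaRoot ∨ (red? Eₗ ∨ red? Eᵣ)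
      ≡⟨ cong₂ (λ x y → viaRoot ∨ (x ∨ y))
               (adjacentTo-mapEdges-∉ (λ x → inLeft≢inRight x i) (treeEdges l) R)
               (adjacentTo-mapEdges inRight-injective (treeEdges r) R i) ⟩
    viaRoot ∨ adjacentTo (treeEdges r) (R ∘ inRight) i
      ≡⟨ ∨-comm viaRoot _ ⟩
    adjacentTo (treeEdges r) (R ∘ inRight) i ∨ viaRoot ∎
    where
    Eₗ = mapEdges inLeft (treeEdges l)
    Eᵣ = mapEdges inRight (treeEdges r)
    red? = λ E → adjacentTo E R (inRight i)
    viaRoot = ⌊ root r ≟ i ⌋ ∧ R zero

  stepBelow-left : ∀ b a Aₗ Aᵣ s {ρ} → redNow (a ∷ (Aₗ ++ᵛ Aᵣ)) s zero ≡ ρ →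
                   stepBelow (node2 l r) b (a ∷ (Aₗ ++ᵛ Aᵣ)) s ∘ inLeft ≗ stepBelow l ρ Aₗ (s ∘ inLeft)
  stepBelow-left b a Aₗ Aᵣ s {ρ} ρ-eq i = cong₂ (λ x → nextColour x (s (inLeft i))) (lookup-++ˡ Aₗ Aᵣ i) (begin
    adjacentTo (treeEdges (node2 l r)) R (inLeft i) ∨ false ≡⟨ ∨-identityʳ _ ⟩
    adjacentTo (treeEdges (node2 l r)) R (inLeft i)         ≡⟨ adjacentTo-left R i ⟩
    adjacentTo (treeEdges l) (R ∘ inLeft) i ∨ viaRoot (R zero)
      ≡⟨ cong₂ (λ x y → x ∨ viaRoot y) (adjacentTo-cong (treeEdges l) R≗ i) ρ-eq ⟩
    adjacentTo (treeEdges l) (redNow Aₗ (s ∘ inLeft)) i ∨ viaRoot ρ ∎)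
    where
    R = redNow (a ∷ (Aₗ ++ᵛ Aᵣ)) s
    R≗ : R ∘ inLeft ≗ redNow Aₗ (s ∘ inLeft)
    R≗ u = cong (λ x → not x ∧ notGreen (s (inLeft u))) (lookup-++ˡ Aₗ Aᵣ u)
    viaRoot = ⌊ root l ≟ i ⌋ ∧_

  stepBelow-right : ∀ b a Aₗ Aᵣ s {ρ} → redNow (a ∷ (Aₗ ++ᵛ Aᵣ)) s zero ≡ ρ →
                    stepBelow (node2 l r) b (a ∷ (Aₗ ++ᵛ Aᵣ)) s ∘ inRight ≗ stepBelow r ρ Aᵣ (s ∘ inRight)
  stepBelow-right b a Aₗ Aᵣ s {ρ} ρ-eq i = cong₂ (λ x → nextColour x (s (inRight i))) (lookup-++ʳ Aₗ Aᵣ i) (begin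
    adjacentTo (treeEdges (node2 l r)) R (inRight i) ∨ false ≡⟨ ∨-identityʳ _ ⟩
    adjacentTo (treeEdges (node2 l r)) R (inRight i)         ≡⟨ adjacentTo-right R i ⟩
    adjacentTo (treeEdges r) (R ∘ inRight) i ∨ viaRoot (R zero)
      ≡⟨ cong₂ (λ x y → x ∨ viaRoot y) (adjacentTo-cong (treeEdges r) R≗ i) ρ-eq ⟩
    adjacentTo (treeEdges r) (redNow Aᵣ (s ∘ inRight)) i ∨ viaRoot ρ ∎)
    where
    R = redNow (a ∷ (Aₗ ++ᵛ Aᵣ)) s
    R≗ : R ∘ inRight ≗ redNow Aᵣ (s ∘ inRight)
    R≗ u = cong (λ x → not x ∧ notGreen (s (inRight u))) (lookup-++ʳ Aₗ Aᵣ u)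
    viaRoot = ⌊ root r ≟ i ⌋ ∧_

  runBelow-node2 : ∀ {X : Set} b (fₗ : X → Subset (size l)) (fᵣ : X → Subset (size r)) P s → s zero ≡ red →
                   let s′ = runBelow (node2 l r) b (map (λ x → false ∷ (fₗ x ++ᵛ fᵣ x)) P) s in
                   s′ zero ≡ red × s′ ∘ inLeft ≗ runBelow l true (map fₗ P) (s ∘ inLeft)
                                 × s′ ∘ inRight ≗ runBelow r true (map fᵣ P) (s ∘ inRight)
  runBelow-node2 b fₗ fᵣ []      s s₀ = s₀ , (λ _ → refl) , (λ _ → refl)
  runBelow-node2 b fₗ fᵣ (x ∷ P) s s₀ =
    proj₁ rest ,
    (λ i → trans (proj₁ (proj₂ rest) i) (runBelow-cong l true (map fₗ P) (stepBelow-left b false Aₗ Aᵣ s infected) i)) ,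
    (λ i → trans (proj₂ (proj₂ rest) i) (runBelow-cong r true (map fᵣ P) (stepBelow-right b false Aₗ Aᵣ s infected) i))
    where
    Aₗ = fₗ x
    Aᵣ = fᵣ x
    infected = cong notGreen s₀
    rest = runBelow-node2 b fₗ fᵣ P (stepBelow (node2 l r) b (false ∷ (Aₗ ++ᵛ Aᵣ)) s) (nextColour-infected _ infected)

  allGreen-node2 : ∀ {s : Colouring (node2 l r)} →
                   s zero ≡ green → AllGreen l (s ∘ inLeft) → AllGreen r (s ∘ inRight) → AllGreen (node2 l r) s
  allGreen-node2             g₀ gₗ gᵣ zero = g₀
  allGreen-node2 {s} g₀ gₗ gᵣ (suc w) with splitAt (size l) w in eq
  ... | inj₁ i = subst (λ w → s (suc w) ≡ green) (splitAt⁻¹-↑ˡ eq) (gₗ i)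
  ... | inj₂ j = subst (λ w → s (suc w) ≡ green) (splitAt⁻¹-↑ʳ eq) (gᵣ j)

  rootImmunized-node2 : ∀ b s → AllGreen l (s ∘ inLeft) → AllGreen r (s ∘ inRight) →
                        AllGreen (node2 l r) (stepBelow (node2 l r) b rootOnly s)
  rootImmunized-node2 b s gₗ gᵣ = allGreen-node2 refl
    (λ i → trans (stepBelow-left b true ∅ ∅ s refl i) (allGreen-step l false ∅ _ (λ ()) gₗ i))
    (λ i → trans (stepBelow-right b true ∅ ∅ s refl i) (allGreen-step r false ∅ _ (λ ()) gᵣ i))

chainDepth : BTree → ℕ
chainDepth (node1 t) = suc (chainDepth t)
chainDepth _         = zero

-- The vertices at depths 0, 1, … of the chain of unary nodes on top of t are coloured cs, the rest green.
ChainColoured : List Colour → (t : BTree) → Colouring t → Set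
ChainColoured []       t         s = AllGreen t s
ChainColoured (c ∷ cs) (node1 t) s = s zero ≡ c × ChainColoured cs t (s ∘ suc)
ChainColoured (c ∷ cs) _         s = ⊥

ChainColoured-cong : ∀ cs t {s s′} → s ≗ s′ → ChainColoured cs t s → ChainColoured cs t s′
ChainColoured-cong []       t         s≗s′ g        v = trans (sym (s≗s′ v)) (g v)
ChainColoured-cong (c ∷ cs) (node1 t) s≗s′ (s₀ , h)   =
  trans (sym (s≗s′ zero)) s₀ , ChainColoured-cong cs t (s≗s′ ∘ suc) h

infectedRoot-step : ∀ cs t b A s → notGreen (s zero) ≡ true → ChainColoured cs t (stepBelow t true A (s ∘ suc)) →
                    ChainColoured (red ∷ cs) (node1 t) (stepBelow (node1 t) b (false ∷ A) s)
infectedRoot-step cs t b A s infected h =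
  nextColour-infected _ infected , ChainColoured-cong cs t (sym ∘ stepBelow-node1 t b false A s infected) h

decayed : ℕ → List Colour
decayed zero    = []
decayed (suc j) = replicate j red ∷ʳ yellow

decay-step : ∀ j t s → suc j ≤ chainDepth t → ChainColoured (decayed j) t s →
             ChainColoured (decayed (suc j)) t (stepBelow t true ∅ s)
decay-step zero          (node1 t) s _       g        =
  cong₂ (nextColour false) (g zero) (∨-zeroʳ _) , λ i →
  trans (stepBelow-node1 t true false ∅ s (cong notGreen (g zero)) i) (allGreen-step t false ∅ (s ∘ suc) (λ ()) (g ∘ suc) i)
decay-step (suc zero)    (node1 t) s (s≤s d) (s₀ , h) =
  infectedRoot-step (decayed 1) t true ∅ s (cong notGreen s₀) (decay-step zero t (s ∘ suc) d h)
decay-step (suc (suc j)) (node1 t) s (s≤s d) (s₀ , h) =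
  infectedRoot-step (decayed (suc (suc j))) t true ∅ s (cong notGreen s₀) (decay-step (suc j) t (s ∘ suc) d h)

decay-run : ∀ {X : Set} j t (P : List X) s → j + length P ≤ chainDepth t → ChainColoured (decayed j) t s →
            ChainColoured (decayed (j + length P)) t (runBelow t true (map (λ _ → ∅) P) s)
decay-run j t []      s _ h rewrite +-identityʳ j = h
decay-run j t (_ ∷ P) s d h rewrite +-suc j (length P) =
  decay-run (suc j) t P _ d (decay-step j t s (≤-trans (s≤s (m≤m+n j (length P))) d) h)

-- Junk (the root) at depths beyond the chain of unary nodes on top of t.
vertexAtDepth : ℕ → (t : BTree) → Fin (size t)
vertexAtDepth (suc j) (node1 t) = suc (vertexAtDepth j t)
vertexAtDepth _       t         = root t

healing : ℕ → (t : BTree) → List (Subset (size t))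
healing zero    t = []
healing (suc j) t = ⁅ vertexAtDepth j t ⁆ ∷ healing j t

heal-step : ∀ j c t s → ChainColoured (replicate j red ∷ʳ c) t s →
            ChainColoured (replicate j red) t (stepBelow t true ⁅ vertexAtDepth j t ⁆ s)
heal-step zero    c (node1 t) s (_ , g)  = rootImmunized-node1 t true s g
heal-step (suc j) c (node1 t) s (s₀ , h) =
  infectedRoot-step (replicate j red) t true _ s (cong notGreen s₀) (heal-step j c t (s ∘ suc) h)

replicate-suc-∷ʳ : ∀ {A : Set} n (x : A) → replicate (suc n) x ≡ replicate n x ∷ʳ x
replicate-suc-∷ʳ zero    x = refl
replicate-suc-∷ʳ (suc n) x = cong (x ∷_) (replicate-suc-∷ʳ n x)

healing-clears : ∀ j c t s → ChainColoured (replicate j red ∷ʳ c) t s →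
                 AllGreen t (runBelow t true (healing (suc j) t) s)
healing-clears zero    c t s h = heal-step zero c t s h
healing-clears (suc j) c t s h =
  healing-clears j red t s′ (subst (λ cs → ChainColoured cs t s′) (replicate-suc-∷ʳ j red) (heal-step (suc j) c t s h))
  where s′ = stepBelow t true ⁅ vertexAtDepth (suc j) t ⁆ s

healing-clears-decayed : ∀ j t s → ChainColoured (decayed j) t s → AllGreen t (runBelow t true (healing j t) s)
healing-clears-decayed zero    t s g = g
healing-clears-decayed (suc j) t s h = healing-clears j yellow t s h

clearing : (t : BTree) → List (Subset (size t))
clearing leaf        = (true ∷ []) ∷ []
clearing (node1 t)   = map (false ∷_) (clearing t) ++ (true ∷ ∅) ∷ []
clearing (node2 l r) =
  map (λ A → false ∷ (A ++ᵛ ∅)) (clearing l) ++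
  map (λ B → false ∷ (∅ ++ᵛ B)) (clearing r) ++
  map (λ A → false ∷ (A ++ᵛ ⁅ root r ⁆)) (healing (length (clearing r)) l) ++
  Node2.rootOnly l r ∷ []

Spaced : BTree → Set
Spaced leaf        = ⊤
Spaced (node1 t)   = Spaced t
Spaced (node2 l r) = Spaced l × Spaced r × length (clearing r) ≤ chainDepth l

runBelow-map-id : ∀ t b P s → runBelow t b (map (λ A → A) P) s ≡ runBelow t b P s
runBelow-map-id t b P s = cong (λ Q → runBelow t b Q s) (map-id P)

clearing-clears : ∀ t b s → Spaced t → AllRed t s → AllGreen t (runBelow t b (clearing t) s)
clearing-clears leaf        b s _ _ zero = refl
clearing-clears (node1 t)   b s spaced s-red =
  subst (AllGreen (node1 t)) (sym (runBelow-++ (node1 t) b P (_ ∷ []) s))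
        (rootImmunized-node1 t b s₁ (ChainColoured-cong [] t (sym ∘ proj₂ phase) childCleared))
  where
  P = map (false ∷_) (clearing t)
  s₁ = runBelow (node1 t) b P s
  phase = runBelow-node1 t b (clearing t) s (s-red zero)
  childCleared = clearing-clears t true (s ∘ suc) spaced (s-red ∘ suc)
clearing-clears (node2 l r) b s (spacedₗ , spacedᵣ , deep) s-red =
  subst (AllGreen N) (sym runs) (rootImmunized-node2 b s₃ green₃ₗ green₃ᵣ)
  where
  open Node2 l r
  N = node2 l r
  Jᵣ = length (clearing r)
  P₁ = map (λ A → false ∷ (A ++ᵛ ∅)) (clearing l)
  P₂ = map (λ B → false ∷ (∅ ++ᵛ B)) (clearing r)
  P₃ = map (λ A → false ∷ (A ++ᵛ ⁅ root r ⁆)) (healing Jᵣ l)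
  s₁ = runBelow N b P₁ s
  s₂ = runBelow N b P₂ s₁
  s₃ = runBelow N b P₃ s₂

  runs : runBelow N b (clearing N) s ≡ stepBelow N b rootOnly s₃
  runs = begin
    runBelow N b (P₁ ++ P₂ ++ P₃ ++ rootOnly ∷ []) s ≡⟨ runBelow-++ N b P₁ _ s ⟩
    runBelow N b (P₂ ++ P₃ ++ rootOnly ∷ []) s₁      ≡⟨ runBelow-++ N b P₂ _ s₁ ⟩
    runBelow N b (P₃ ++ rootOnly ∷ []) s₂           ≡⟨ runBelow-++ N b P₃ _ s₂ ⟩
    stepBelow N b rootOnly s₃                       ∎

  phase₁ = runBelow-node2 b (λ A → A) (λ _ → ∅) (clearing l) s (s-red zero)
  phase₂ = runBelow-node2 b (λ _ → ∅) (λ B → B) (clearing r) s₁ (proj₁ phase₁)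
  phase₃ = runBelow-node2 b (λ A → A) (λ _ → ⁅ root r ⁆) (healing Jᵣ l) s₂ (proj₁ phase₂)

  green₁ₗ : AllGreen l (s₁ ∘ inLeft)
  green₁ₗ = ChainColoured-cong [] l (sym ∘ proj₁ (proj₂ phase₁))
    (subst (AllGreen l) (sym (runBelow-map-id l true (clearing l) _)) (clearing-clears l true _ spacedₗ (s-red ∘ inLeft)))
  red₁ᵣ : AllRed r (s₁ ∘ inRight)
  red₁ᵣ i = trans (proj₂ (proj₂ phase₁) i)
    (runBelow-invariant r true ∅ (AllRed r) (allRed-step r true) (clearing l) _ (s-red ∘ inRight) i)

  decayed₂ₗ : ChainColoured (decayed Jᵣ) l (s₂ ∘ inLeft)
  decayed₂ₗ = ChainColoured-cong (decayed Jᵣ) l (sym ∘ proj₁ (proj₂ phase₂))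
    (decay-run 0 l (clearing r) _ deep green₁ₗ)
  green₂ᵣ : AllGreen r (s₂ ∘ inRight)
  green₂ᵣ = ChainColoured-cong [] r (sym ∘ proj₂ (proj₂ phase₂))
    (subst (AllGreen r) (sym (runBelow-map-id r true (clearing r) _)) (clearing-clears r true _ spacedᵣ red₁ᵣ))

  green₃ₗ : AllGreen l (s₃ ∘ inLeft)
  green₃ₗ = ChainColoured-cong [] l (sym ∘ proj₁ (proj₂ phase₃))
    (subst (AllGreen l) (sym (runBelow-map-id l true (healing Jᵣ l) _)) (healing-clears-decayed Jᵣ l _ decayed₂ₗ))
  green₃ᵣ : AllGreen r (s₃ ∘ inRight)
  green₃ᵣ = ChainColoured-cong [] r (sym ∘ proj₂ (proj₂ phase₃))
    (runBelow-invariant r true ⁅ root r ⁆ (AllGreen r) (λ σ → allGreen-step r true ⁅ root r ⁆ σ rootShielded)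
                        (healing Jᵣ l) _ green₂ᵣ)
    where rootShielded = λ _ → []=⇒lookup (x∈⁅x⁆ (root r))

∣p++q∣≡∣p∣+∣q∣ : (p : Subset m) (q : Subset n) → ∣ p ++ᵛ q ∣ ≡ ∣ p ∣ + ∣ q ∣
∣p++q∣≡∣p∣+∣q∣ []          q = refl
∣p++q∣≡∣p∣+∣q∣ (true ∷ p)  q = cong suc (∣p++q∣≡∣p∣+∣q∣ p q)
∣p++q∣≡∣p∣+∣q∣ (false ∷ p) q = ∣p++q∣≡∣p∣+∣q∣ p q

∣p++q∣≤ : ∀ (p : Subset m) (q : Subset n) {a b} → ∣ p ∣ ≤ a → ∣ q ∣ ≤ b → ∣ p ++ᵛ q ∣ ≤ a + b
∣p++q∣≤ p q p≤a q≤b = subst (_≤ _) (sym (∣p++q∣≡∣p∣+∣q∣ p q)) (+-mono-≤ p≤a q≤b)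

∣∅∣≤ : ∀ n k → ∣ ∅ {n} ∣ ≤ k
∣∅∣≤ n k = ≤-trans (≤-reflexive (∣⊥∣≡0 n)) z≤n

healing-width : ∀ j t → All (λ A → ∣ A ∣ ≤ 1) (healing j t)
healing-width zero    t = []
healing-width (suc j) t = ≤-reflexive (∣⁅x⁆∣≡1 (vertexAtDepth j t)) ∷ healing-width j t

clearing-width : ∀ t → WidthAtMost (treeGraph t) 2 (clearing t)
clearing-width leaf        = s≤s z≤n ∷ []
clearing-width (node1 t)   = ++⁺ (map⁺ (clearing-width t)) (s≤s (∣∅∣≤ (size t) 1) ∷ [])
clearing-width (node2 l r) =
  ++⁺ (gmap⁺ (λ {A} → phase₁ A) (clearing-width l)) (
  ++⁺ (gmap⁺ (λ {B} → phase₂ B) (clearing-width r)) (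
  ++⁺ (gmap⁺ (λ {A} → phase₃ A) (healing-width (length (clearing r)) l))
      (s≤s (∣p++q∣≤ (∅ {size l}) (∅ {size r}) (∣∅∣≤ (size l) 0) (∣∅∣≤ (size r) 1)) ∷ [])))
  where
  phase₁ : ∀ A → ∣ A ∣ ≤ 2 → ∣ A ++ᵛ ∅ {size r} ∣ ≤ 2
  phase₁ A w = ∣p++q∣≤ A ∅ w (∣∅∣≤ (size r) 0)
  phase₂ : ∀ B → ∣ B ∣ ≤ 2 → ∣ ∅ {size l} ++ᵛ B ∣ ≤ 2
  phase₂ B w = ∣p++q∣≤ (∅ {size l}) B (∣∅∣≤ (size l) 0) w
  phase₃ : ∀ A → ∣ A ∣ ≤ 1 → ∣ A ++ᵛ ⁅ root r ⁆ ∣ ≤ 2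
  phase₃ A w = ∣p++q∣≤ A ⁅ root r ⁆ w (≤-reflexive (∣⁅x⁆∣≡1 (root r)))

spacedSubdivision : (T : BTree) → Subdiv T
spacedSubdivision leaf        = leaf
spacedSubdivision (node1 t)   = node1 0 (spacedSubdivision t)
spacedSubdivision (node2 l r) =
  node2 (length (clearing (subdivide (spacedSubdivision r)))) (spacedSubdivision l) 0 (spacedSubdivision r)

chain-spaced : ∀ k t → Spaced t → Spaced (chain k t)
chain-spaced zero    t spaced = spaced
chain-spaced (suc k) t spaced = chain-spaced k t spaced

chainDepth-chain : ∀ k t → k ≤ chainDepth (chain k t)
chainDepth-chain zero    t = z≤n
chainDepth-chain (suc k) t = s≤s (chainDepth-chain k t)

spacedSubdivision-spaced : ∀ T → Spaced (subdivide (spacedSubdivision T))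
spacedSubdivision-spaced leaf        = tt
spacedSubdivision-spaced (node1 t)   = spacedSubdivision-spaced t
spacedSubdivision-spaced (node2 l r) =
  chain-spaced k l′ (spacedSubdivision-spaced l) , spacedSubdivision-spaced r , chainDepth-chain k l′
  where
  l′ = subdivide (spacedSubdivision l)
  k = length (clearing (subdivide (spacedSubdivision r)))

corollary5p4 : (T : BTree) → Σ (Subdiv T) λ S → i₁₁≤ (treeGraph (subdivide S)) 2
corollary5p4 T = spacedSubdivision T , clearing T′ , clearing-width T′ , clears
  where
  T′ = subdivide (spacedSubdivision T)
  clears : Clears (treeGraph T′) (clearing T′)
  clears v = trans (run-treeGraph T′ (clearing T′) v)
                   (clearing-clears T′ false (allRed (treeGraph T′)) (spacedSubdivision-spaced T) (λ _ → refl) v)
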